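{- Let $k\ge1$ and $n\ge1$, and let $P$ be a $k$-Dyck path of length $n$ with associated ascending parking preference $\alpha=(a_1,\dots,a_n)$. Then $\alpha$ is a $k$-Naples parking function if and only if, for every Down step of $P$ that takes the path below the line $y=0$ (i.e. from height $0$ to height $-1$), the path crosses back above the line $y=0$ (reaches height $1$) at some point within the $2k$ steps immediately following that Down step.
   Context: A lattice path consists of Up steps $(1,1)$ and Down steps $(1,-1)$ starting at $(0,0)$. A $k$-Dyck path of length $n$ is such a path with $n$ Up steps and $n$ Down steps (so it ends at $(2n,0)$) that never goes below the line $y=-k$ and whose last step is a Down step. The associated parking preference of $P$ is $\alpha=(a_1,\dots,a_n)$ where $a_i$ is $1$ plus the number of Down steps preceding the $i$-th Up step; it is weakly increasing. Parking rules: $n$ spots $1,\dots,n$, cars $c_1,\dots,c_n$ arrive in order, $a_j$ is the preferred spot of $c_j$; $k$-Naples rule: $c_j$ parks at $a_j$ if empty, otherwise checks $a_j-1,\dots,a_j-k$ (those $\ge1$) in order and parks at the first empty one, otherwise drives forward from $a_j$ and parks at the first empty spot after $a_j$ (failing if none). The preference is a $k$-Naples parking function if all cars park. -}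

module Defs where

open import Data.Nat using (ℕ; zero; suc; _+_; _*_; _∸_; _≤_; _<_; _≤ᵇ_; _≡ᵇ_)
open import Data.Bool using (Bool; true; false; _∧_; not; if_then_else_)
open import Data.Integer as ℤ using (ℤ; +_)
open import Data.List using (List; []; _∷_; length; take; last; lookup)
open import Data.Bool.ListAction using (any)
open import Data.Maybe using (Maybe; just; nothing; _<∣>_)
open import Data.Fin using (Fin; toℕ)
open import Data.Product using (_×_; ∃)
open import Relation.Binary.PropositionalEquality using (_≡_)

-- Lattice path steps: Up = (1,1), Down = (1,-1)
data Step : Set where
  U D : Step

Path : Set
Path = List Step

#U : Path → ℕ
#U []       = 0
#U (U ∷ p)  = suc (#U p)
#U (D ∷ p)  = #U p

#D : Path → ℕ
#D []       = 0
#D (U ∷ p)  = #D p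
#D (D ∷ p)  = suc (#D p)

height : Path → ℤ
height p = + #U p ℤ.- + #D p

IsKDyck : ℕ → ℕ → Path → Set
IsKDyck k n P =
  #U P ≡ n × #D P ≡ n
  × (∀ m → m ≤ length P → ℤ.- (+ k) ℤ.≤ height (take m P))
  × last P ≡ just D

prefFrom : ℕ → Path → List ℕ
prefFrom d []       = []
prefFrom d (U ∷ p)  = suc d ∷ prefFrom d p
prefFrom d (D ∷ p)  = prefFrom (suc d) p

parkingPreference : Path → List ℕ
parkingPreference = prefFrom 0

isFree : ℕ → List ℕ → ℕ → Bool
isFree n occ s = (1 ≤ᵇ s) ∧ (s ≤ᵇ n) ∧ not (any (λ t → t ≡ᵇ s) occ)

-- tries spots a-1, a-2, ..., a-j (in this order), only those ≥ 1
backSearch : ℕ → List ℕ → ℕ → ℕ → Maybe ℕ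
backSearch n occ a zero    = nothing
backSearch n occ a (suc j) =
  backSearch n occ a j <∣> (if (suc j ≤ᵇ a ∸ 1) ∧ isFree n occ (a ∸ suc j)
                              then just (a ∸ suc j) else nothing)

-- first free spot among s, s+1, ... (fuel bounds the search; spots > n are never free)
fwdSearch : ℕ → List ℕ → ℕ → ℕ → Maybe ℕ
fwdSearch n occ zero     s = nothing
fwdSearch n occ (suc f)  s = if isFree n occ s then just s else fwdSearch n occ f (suc s)

naplesSpot : ℕ → ℕ → List ℕ → ℕ → Maybe ℕ
naplesSpot k n occ a =
  if isFree n occ a then just a
  else (backSearch n occ a k <∣> fwdSearch n occ n (suc a))

naplesPark : ℕ → ℕ → List ℕ → List ℕ → Maybe (List ℕ)
naplesPark k n occ []       = just occ
naplesPark k n occ (a ∷ as) with naplesSpot k n occ a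
... | nothing = nothing
... | just s  = naplesPark k n (s ∷ occ) as

IsKNaplesPF : ℕ → ℕ → List ℕ → Set
IsKNaplesPF k n α = ∃ λ occ → naplesPark k n [] α ≡ just occ

-- Every Down step from height 0 to height -1 (step number i+1, 0-based index i)
-- is followed, within the next 2k steps, by reaching height 1.
ReturnsAboveWithin2k : ℕ → Path → Set
ReturnsAboveWithin2k k P =
  (i : Fin (length P)) → lookup P i ≡ D → height (take (toℕ i) P) ≡ + 0 →
  ∃ λ m → suc (toℕ i) < m × m ≤ suc (toℕ i) + 2 * k × m ≤ length P
          × height (take m P) ≡ + 1

-- Read the path step by step, keeping u (Up steps so far, i.e. cars parked) and d (Down steps
-- so far, so that the next car prefers spot d + 1).  While the height u - d is ≥ 0 the occupied
-- spots are exactly 1, …, u.  A Down step from height 0 leaves spot s = d + 1 empty.  If the path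
-- reaches height 1 within the next 2k steps, every car of this excursion prefers a spot ≤ s + k,
-- hence parks at or behind its preference (otherwise all of 1, …, d + 1 would be taken by u ≤ d
-- cars), and on reaching height 1 the spots 1, …, u are full again.  If it does not, spot s is never
-- taken: a car parking there while the path is below height 0 would again leave 1, …, d + 1 taken
-- by at most d cars, and later cars prefer spots beyond s + k.  Then n cars cannot fill n spots.

module Submission where

open import Defs
open import Data.Bool using (Bool; true; false; _∧_; _∨_; if_then_else_)
open import Data.Bool.Properties using (T-≡)
open import Data.Bool.ListAction using (any)
open import Data.Empty using (⊥; ⊥-elim)
open import Data.Fin using (Fin; toℕ; fromℕ<; zero; suc)
open import Data.Fin.Properties using (toℕ-fromℕ<)
open import Data.Integer as ℤ using (+_)
open import Data.Integer.Properties
  using (i-j≡0⇒i≡j; i≡j⇒i-j≡0; +-injective; minus-suc; [+m]-[+n]≡m⊖n; ⊖-≥)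
open import Data.List using (List; []; _∷_; length; take; drop; last; lookup)
open import Data.List.Properties using (length-drop; take-all; ∷-injectiveˡ)
open import Data.Maybe using (Maybe; just; nothing)
open import Data.Nat
  using (ℕ; zero; suc; _+_; _*_; _∸_; _≤_; _<_; _≤ᵇ_; _≡ᵇ_; _≤?_; _<?_; _≟_; z≤n; s≤s; s≤s⁻¹)
open import Data.Nat.Properties
open import Data.Nat.Solver using (module +-*-Solver)
open import Data.Product using (_×_; _,_; proj₁; proj₂; Σ; ∃)
open import Data.Sum using (_⊎_; inj₁; inj₂; map₂)
open import Function using (_⇔_; mk⇔; Equivalence; _∘_)
open import Function.Properties.Equivalence using (⇔-isEquivalence)
open import Relation.Binary.Definitions using (tri<; tri≈; tri>)
open import Relation.Binary.PropositionalEquality using (_≡_; _≢_; refl; sym; trans; cong; cong₂; subst; subst₂)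
open import Relation.Binary.Structures using (IsEquivalence)
open import Relation.Nullary using (¬_; Dec; yes; no; contradiction)
open import Relation.Nullary.Decidable using (map′; _×-dec_)

private module ⇔ {ℓ} = IsEquivalence (⇔-isEquivalence {ℓ})

module _ {A : Set} where

  drop-∷⇒< : ∀ m (xs : List A) {x q} → drop m xs ≡ x ∷ q → m < length xs
  drop-∷⇒< zero    (y ∷ ys) refl = s≤s z≤n
  drop-∷⇒< (suc m) (y ∷ ys) e    = s≤s (drop-∷⇒< m ys e)

  drop-[]⇒≤ : ∀ m (xs : List A) → drop m xs ≡ [] → length xs ≤ m
  drop-[]⇒≤ m xs e = m∸n≡0⇒m≤n (trans (sym (length-drop m xs)) (cong length e))

  drop-suc-∷ : ∀ m (xs : List A) {x q} → drop m xs ≡ x ∷ q → drop (suc m) xs ≡ q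
  drop-suc-∷ zero    (y ∷ ys) refl = refl
  drop-suc-∷ (suc m) (y ∷ ys) e    = drop-suc-∷ m ys e

  drop-toℕ : ∀ (xs : List A) (i : Fin (length xs)) → drop (toℕ i) xs ≡ lookup xs i ∷ drop (suc (toℕ i)) xs
  drop-toℕ (x ∷ xs) zero    = refl
  drop-toℕ (x ∷ xs) (suc i) = drop-toℕ xs i

#U-take-suc : ∀ m p {x q} → drop m p ≡ x ∷ q → #U (take (suc m) p) ≡ #U (take m p) + #U (x ∷ [])
#U-take-suc zero    (x ∷ q) refl = refl
#U-take-suc (suc m) (U ∷ p) e    = cong suc (#U-take-suc m p e)
#U-take-suc (suc m) (D ∷ p) e    = #U-take-suc m p e

#D-take-suc : ∀ m p {x q} → drop m p ≡ x ∷ q → #D (take (suc m) p) ≡ #D (take m p) + #D (x ∷ [])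
#D-take-suc zero    (x ∷ q) refl = refl
#D-take-suc (suc m) (U ∷ p) e    = #D-take-suc m p e
#D-take-suc (suc m) (D ∷ p) e    = cong suc (#D-take-suc m p e)

#U+#D-take : ∀ m p → m ≤ length p → #U (take m p) + #D (take m p) ≡ m
#U+#D-take zero    p       _         = refl
#U+#D-take (suc m) (U ∷ p) (s≤s m≤p) = cong suc (#U+#D-take m p m≤p)
#U+#D-take (suc m) (D ∷ p) (s≤s m≤p) = trans (+-suc _ _) (cong suc (#U+#D-take m p m≤p))

#U-take-≤ : ∀ m p → #U (take m p) ≤ #U p
#U-take-≤ zero    p       = z≤n
#U-take-≤ (suc m) []      = z≤n
#U-take-≤ (suc m) (U ∷ p) = s≤s (#U-take-≤ m p)
#U-take-≤ (suc m) (D ∷ p) = #U-take-≤ m p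

#D-take-≤ : ∀ m p → #D (take m p) ≤ #D p
#D-take-≤ zero    p       = z≤n
#D-take-≤ (suc m) []      = z≤n
#D-take-≤ (suc m) (U ∷ p) = #D-take-≤ m p
#D-take-≤ (suc m) (D ∷ p) = s≤s (#D-take-≤ m p)

#D-take-mono : ∀ {m r} p → m ≤ r → #D (take m p) ≤ #D (take r p)
#D-take-mono {zero}          p       _         = z≤n
#D-take-mono {suc m} {suc r} []      _         = z≤n
#D-take-mono {suc m} {suc r} (U ∷ p) (s≤s m≤r) = #D-take-mono p m≤r
#D-take-mono {suc m} {suc r} (D ∷ p) (s≤s m≤r) = s≤s (#D-take-mono p m≤r)

#D-take-< : ∀ m p {q} → last p ≡ just D → drop m p ≡ U ∷ q → suc (#D (take m p)) ≤ #D p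
#D-take-< zero    (U ∷ q) e refl = 1≤#D q e
  where
  1≤#D : ∀ p → last (U ∷ p) ≡ just D → 1 ≤ #D p
  1≤#D (D ∷ p)         _ = s≤s z≤n
  1≤#D (U ∷ p@(_ ∷ _)) e = 1≤#D p e
#D-take-< (suc m) (U ∷ p@(_ ∷ _)) e d = #D-take-< m p e d
#D-take-< (suc m) (D ∷ p@(_ ∷ _)) e d = s≤s (#D-take-< m p e d)
#D-take-< (suc zero)    (D ∷ []) _ ()
#D-take-< (suc (suc m)) (D ∷ []) _ ()

height≡0⇒ : ∀ u d → + u ℤ.- + d ≡ + 0 → u ≡ d
height≡0⇒ u d e = +-injective (i-j≡0⇒i≡j (+ u) (+ d) e)

height≡0⇐ : ∀ u → + u ℤ.- + u ≡ + 0
height≡0⇐ u = i≡j⇒i-j≡0 {+ u} refl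

height≡1⇒ : ∀ u d → + u ℤ.- + d ≡ + 1 → u ≡ suc d
height≡1⇒ u d e = +-injective (i-j≡0⇒i≡j (+ u) (+ suc d) (trans (minus-suc (+ u) d) (cong ℤ.pred e)))

height≡1⇐ : ∀ d → + suc d ℤ.- + d ≡ + 1
height≡1⇐ d = trans ([+m]-[+n]≡m⊖n (suc d) d) (trans (⊖-≥ (n≤1+n d)) (cong +_ (m+n∸n≡m 1 d)))

raised-position : ∀ r p → r ≤ length p → height (take r p) ≡ + 1 → r ≡ suc (#D (take r p) + #D (take r p))
raised-position r p r≤p h =
  sym (trans (cong (_+ #D (take r p)) (sym (height≡1⇒ _ _ h))) (#U+#D-take r p r≤p))

twice-+ : ∀ e k → (e + k) + (e + k) ≡ (e + e) + 2 * k
twice-+ = solve 2 (λ e k → (e :+ k) :+ (e :+ k) := (e :+ e) :+ (con 2 :* k)) refl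
  where open +-*-Solver

double-≤ : ∀ {d} e k → d ≤ e + k → d + d ≤ (e + e) + 2 * k
double-≤ {d} e k d≤e+k = subst (d + d ≤_) (twice-+ e k) (+-mono-≤ d≤e+k d≤e+k)

halve-≤ : ∀ {d} e k → d + d ≤ (e + e) + 2 * k → d ≤ e + k
halve-≤ {d} e k dd≤ = ≮⇒≥ λ e+k<d →
  contradiction (subst (_< d + d) (twice-+ e k) (+-mono-< e+k<d e+k<d)) (≤⇒≯ dd≤)

≡ᵇ-true⇒≡ : ∀ {m n} → (m ≡ᵇ n) ≡ true → m ≡ n
≡ᵇ-true⇒≡ {m} {n} e = ≡ᵇ⇒≡ m n (Equivalence.from T-≡ e)

≡ᵇ-refl : ∀ m → (m ≡ᵇ m) ≡ true
≡ᵇ-refl m = Equivalence.to T-≡ (≡⇒≡ᵇ m m refl)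

≢⇒≡ᵇ-false : ∀ {m n} → m ≢ n → (m ≡ᵇ n) ≡ false
≢⇒≡ᵇ-false {m} {n} m≢n with m ≡ᵇ n in e
... | false = refl
... | true  = contradiction (≡ᵇ-true⇒≡ e) m≢n

≤ᵇ-true⇒≤ : ∀ {m n} → (m ≤ᵇ n) ≡ true → m ≤ n
≤ᵇ-true⇒≤ {m} {n} e = ≤ᵇ⇒≤ m n (Equivalence.from T-≡ e)

≤⇒≤ᵇ-true : ∀ {m n} → m ≤ n → (m ≤ᵇ n) ≡ true
≤⇒≤ᵇ-true m≤n = Equivalence.to T-≡ (≤⇒≤ᵇ m≤n)

occupied : List ℕ → ℕ → Bool
occupied occ t = any (_≡ᵇ t) occ

occupied-here : ∀ t occ → occupied (t ∷ occ) t ≡ true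
occupied-here t occ = cong (_∨ occupied occ t) (≡ᵇ-refl t)

occupied-there : ∀ t occ x → occupied occ x ≡ true → occupied (t ∷ occ) x ≡ true
occupied-there t occ x e with t ≡ᵇ x
... | true  = refl
... | false = e

occupied-∷⁻ : ∀ t occ x → occupied (t ∷ occ) x ≡ true → x ≡ t ⊎ occupied occ x ≡ true
occupied-∷⁻ t occ x e with t ≡ᵇ x in t≡ᵇx
... | true  = inj₁ (sym (≡ᵇ-true⇒≡ t≡ᵇx))
... | false = inj₂ e

unoccupied-∷ : ∀ occ {t x} → t ≢ x → occupied occ x ≡ false → occupied (t ∷ occ) x ≡ false
unoccupied-∷ occ t≢x e rewrite ≢⇒≡ᵇ-false t≢x = e

unoccupied-beyond : ∀ occ {b t} → (∀ x → occupied occ x ≡ true → x ≤ b) → b < t →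
                    occupied occ t ≡ false
unoccupied-beyond occ {t = t} bound b<t with occupied occ t in o
... | true  = contradiction (bound t o) (<⇒≱ b<t)
... | false = refl

bounded-∷ : ∀ occ {t b} → t ≤ b → (∀ x → occupied occ x ≡ true → x ≤ b) →
            ∀ x → occupied (t ∷ occ) x ≡ true → x ≤ b
bounded-∷ occ {t} t≤b bound x o with occupied-∷⁻ t occ x o
... | inj₁ refl = t≤b
... | inj₂ o′   = bound x o′

countTo : (ℕ → Bool) → ℕ → ℕ
countTo f zero    = 0
countTo f (suc N) = if f (suc N) then suc (countTo f N) else countTo f N

module _ (f : ℕ → Bool) where

  countTo-≤ : ∀ N → countTo f N ≤ N
  countTo-≤ zero = z≤n
  countTo-≤ (suc N) with f (suc N)
  ... | true  = s≤s (countTo-≤ N)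
  ... | false = m≤n⇒m≤1+n (countTo-≤ N)

  countTo-≤-suc : ∀ N → countTo f N ≤ countTo f (suc N)
  countTo-≤-suc N with f (suc N)
  ... | true  = n≤1+n _
  ... | false = ≤-refl

  countTo-mono : ∀ {M N} → M ≤ N → countTo f M ≤ countTo f N
  countTo-mono {N = zero}  z≤n = ≤-refl
  countTo-mono {N = suc N} M≤1+N with m≤n⇒m<n∨m≡n M≤1+N
  ... | inj₁ M≤N  = ≤-trans (countTo-mono (m<1+n⇒m≤n M≤N)) (countTo-≤-suc N)
  ... | inj₂ refl = ≤-refl

  countTo-all : ∀ N → (∀ t → 1 ≤ t → t ≤ N → f t ≡ true) → countTo f N ≡ N
  countTo-all zero    _   = refl
  countTo-all (suc N) all rewrite all (suc N) (s≤s z≤n) ≤-refl =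
    cong suc (countTo-all N λ t 1≤t t≤N → all t 1≤t (m≤n⇒m≤1+n t≤N))

  countTo-missing : ∀ {t} N → f t ≡ false → 1 ≤ t → t ≤ N → countTo f N < N
  countTo-missing zero    _  (s≤s _) ()
  countTo-missing (suc N) ft 1≤t t≤1+N with f (suc N) in e
  ... | false = s≤s (countTo-≤ N)
  ... | true  = s≤s (countTo-missing N ft 1≤t (m<1+n⇒m≤n (≤∧≢⇒< t≤1+N t≢1+N)))
    where
    t≢1+N : _ ≢ suc N
    t≢1+N refl = contradiction (trans (sym ft) e) λ ()

  countTo-beyond : ∀ {b} N → (∀ t → f t ≡ true → t ≤ b) → b ≤ N → countTo f N ≡ countTo f b
  countTo-beyond zero    _     z≤n = refl
  countTo-beyond (suc N) bound b≤1+N with m≤n⇒m<n∨m≡n b≤1+N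
  ... | inj₂ refl = refl
  ... | inj₁ b≤N with f (suc N) in e
  ...   | true  = contradiction (bound (suc N) e) (<⇒≱ b≤N)
  ...   | false = countTo-beyond N bound (m<1+n⇒m≤n b≤N)

countTo-cong : ∀ {f g} N → (∀ t → 1 ≤ t → t ≤ N → f t ≡ g t) → countTo f N ≡ countTo g N
countTo-cong zero    _  = refl
countTo-cong {f} {g} (suc N) eq rewrite eq (suc N) (s≤s z≤n) ≤-refl
                                      | countTo-cong N (λ t 1≤t t≤N → eq t 1≤t (m≤n⇒m≤1+n t≤N)) = refl

countTo-insert : ∀ f {t} N → f t ≡ false → 1 ≤ t → t ≤ N →
                 countTo (λ x → (t ≡ᵇ x) ∨ f x) N ≡ suc (countTo f N)
countTo-insert f zero    _ (s≤s _) ()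
countTo-insert f {t} (suc N) ft 1≤t t≤1+N with m≤n⇒m<n∨m≡n t≤1+N
... | inj₂ refl rewrite ≡ᵇ-refl t | ft =
  cong suc (countTo-cong N λ x _ x≤N →
    cong (_∨ f x) (≢⇒≡ᵇ-false {suc N} {x} λ { refl → <⇒≱ (s≤s ≤-refl) x≤N }))
... | inj₁ t≤N rewrite ≢⇒≡ᵇ-false (<⇒≢ t≤N) | countTo-insert f N ft 1≤t (m<1+n⇒m≤n t≤N)
  with f (suc N)
...   | true  = refl
...   | false = refl

∸-suc-bounds : ∀ {a} j → suc j ≤ a ∸ 1 → 1 ≤ a ∸ suc j × a ∸ suc j < a × a ≡ a ∸ suc j + suc j
∸-suc-bounds {suc a} j p =
  m+n≤o⇒m≤o∸n 1 (s≤s p) , s≤s (m∸n≤m a j) , sym (m∸n+n≡m (s≤s (≤-trans (n≤1+n j) p)))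

module Lot (n : ℕ) where

  isFree⇒ : ∀ occ s → isFree n occ s ≡ true → 1 ≤ s × s ≤ n × occupied occ s ≡ false
  isFree⇒ occ s e with 1 ≤ᵇ s in e₁ | s ≤ᵇ n in e₂ | occupied occ s
  ... | true | true | false = ≤ᵇ-true⇒≤ e₁ , ≤ᵇ-true⇒≤ e₂ , refl

  isFree⇐ : ∀ occ {s} → 1 ≤ s → s ≤ n → occupied occ s ≡ false → isFree n occ s ≡ true
  isFree⇐ occ 1≤s s≤n e rewrite ≤⇒≤ᵇ-true 1≤s | ≤⇒≤ᵇ-true s≤n | e = refl

  free⇒unoccupied : ∀ occ t → isFree n occ t ≡ true → occupied occ t ≡ true → ⊥
  free⇒unoccupied occ t f o = contradiction (trans (sym o) (proj₂ (proj₂ (isFree⇒ occ t f)))) λ ()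

  occupied⇒taken : ∀ occ s → occupied occ s ≡ true → isFree n occ s ≡ false
  occupied⇒taken occ s o with isFree n occ s in f
  ... | false = refl
  ... | true  = ⊥-elim (free⇒unoccupied occ s f o)

  taken⇒occupied : ∀ occ {s} → isFree n occ s ≡ false → 1 ≤ s → s ≤ n → occupied occ s ≡ true
  taken⇒occupied occ {s} f 1≤s s≤n rewrite ≤⇒≤ᵇ-true 1≤s | ≤⇒≤ᵇ-true s≤n with occupied occ s
  ... | true = refl

  occupiedCount : List ℕ → ℕ
  occupiedCount occ = countTo (occupied occ) n

  occupiedCount-∷ : ∀ occ t → isFree n occ t ≡ true → occupiedCount (t ∷ occ) ≡ suc (occupiedCount occ)
  occupiedCount-∷ occ t f =
    let 1≤t , t≤n , vacant = isFree⇒ occ t f in countTo-insert (occupied occ) n vacant 1≤t t≤n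

  crowded : ∀ occ {b} → (∀ t → 1 ≤ t → t ≤ b → occupied occ t ≡ true) → b ≤ n →
            b ≤ occupiedCount occ
  crowded occ {b} all b≤n = subst (_≤ occupiedCount occ) (countTo-all _ b all) (countTo-mono _ b≤n)

  packed : ∀ occ {u} → (∀ t → occupied occ t ≡ true → t ≤ u) → occupiedCount occ ≡ u → u ≤ n →
           ∀ t → 1 ≤ t → t ≤ u → occupied occ t ≡ true
  packed occ {u} bound count u≤n t 1≤t t≤u with occupied occ t in e
  ... | true  = refl
  ... | false = contradiction (subst (_< u) countTo-u≡u (countTo-missing _ u e 1≤t t≤u)) (<-irrefl refl)
    where
    countTo-u≡u : countTo (occupied occ) u ≡ u
    countTo-u≡u = trans (sym (countTo-beyond _ n bound u≤n)) count

  -- backSearch n occ a (suc j) is definitionally backSearch n occ a j <∣> backStep occ a j.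
  backStep : List ℕ → ℕ → ℕ → Maybe ℕ
  backStep occ a j = if (suc j ≤ᵇ a ∸ 1) ∧ isFree n occ (a ∸ suc j) then just (a ∸ suc j) else nothing

  backStep-nothing : ∀ {occ a} j → backStep occ a j ≡ nothing → suc j ≤ a ∸ 1 →
                     isFree n occ (a ∸ suc j) ≡ false
  backStep-nothing {occ} {a} j e p rewrite ≤⇒≤ᵇ-true p with isFree n occ (a ∸ suc j)
  ... | false = refl

  backStep-just : ∀ {occ a t} j → backStep occ a j ≡ just t →
                  suc j ≤ a ∸ 1 × isFree n occ t ≡ true × t ≡ a ∸ suc j
  backStep-just {occ} {a} j e with suc j ≤ᵇ a ∸ 1 in c | isFree n occ (a ∸ suc j) in f
  backStep-just j refl | true | true = ≤ᵇ-true⇒≤ c , f , refl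

  backSearch-nothing : ∀ {occ a t} j → backSearch n occ a j ≡ nothing →
                       1 ≤ t → t < a → a ≤ t + j → isFree n occ t ≡ false
  backSearch-nothing {t = t} zero _ _ t<a a≤t+0 =
    contradiction (subst (_ ≤_) (+-identityʳ t) a≤t+0) (<⇒≱ t<a)
  backSearch-nothing {occ} {a} {t} (suc j) e 1≤t t<a a≤t+1+j with backSearch n occ a j in e₀ | a ≤? t + j
  ... | nothing | yes a≤t+j = backSearch-nothing j e₀ 1≤t t<a a≤t+j
  ... | nothing | no  a≰t+j with ≤-antisym a≤t+1+j (subst (_≤ a) (sym (+-suc t j)) (≰⇒> a≰t+j))
  backSearch-nothing {occ} {t = suc t'} (suc j) e (s≤s z≤n) _ _ | nothing | no _ | refl =
    subst (λ x → isFree n occ x ≡ false) (m+n∸n≡m (suc t') (suc j))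
          (backStep-nothing {occ} {suc t' + suc j} j e (m≤n+m (suc j) t'))

  backSearch-just : ∀ {occ a t} j → backSearch n occ a j ≡ just t →
                    1 ≤ t × t < a × a ≤ t + j × isFree n occ t ≡ true
  backSearch-just {occ} {a} {t} (suc j) e with backSearch n occ a j in e₀
  ... | just _ with e
  ...   | refl = let 1≤t , t<a , a≤t+j , free = backSearch-just j e₀ in
                 1≤t , t<a , ≤-trans a≤t+j (+-monoʳ-≤ t (n≤1+n j)) , free
  backSearch-just {occ} {a} (suc j) e | nothing with backStep-just {occ} {a} j e
  ... | 1+j≤a∸1 , free , refl = let 1≤t , t<a , a≡t+1+j = ∸-suc-bounds j 1+j≤a∸1 in
                                1≤t , t<a , ≤-reflexive a≡t+1+j , free

  backSearch-first : ∀ {occ a t} j → backSearch n occ a j ≡ just t →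
                     ∀ t' → t < t' → t' < a → isFree n occ t' ≡ false
  backSearch-first {occ} {a} (suc j) e t' t<t' t'<a with backSearch n occ a j in e₀
  ... | just _ with e
  ...   | refl = backSearch-first j e₀ t' t<t' t'<a
  backSearch-first {occ} {a} (suc j) e t' t<t' t'<a | nothing with backStep-just {occ} {a} j e
  ... | 1+j≤a∸1 , _ , refl =
    let 1≤t , _ , a≡t+1+j = ∸-suc-bounds j 1+j≤a∸1 in
    backSearch-nothing j e₀ (≤-trans 1≤t (<⇒≤ t<t')) t'<a
      (≤-trans (≤-reflexive (trans a≡t+1+j (+-suc _ j))) (+-monoˡ-≤ j t<t'))

  fwdSearch-just : ∀ {occ t} f s → fwdSearch n occ f s ≡ just t → s ≤ t × isFree n occ t ≡ true
  fwdSearch-just {occ} (suc f) s e with isFree n occ s in free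
  fwdSearch-just (suc f) s refl | true = ≤-refl , free
  ... | false = let s<t , free-t = fwdSearch-just f (suc s) e in <⇒≤ s<t , free-t

  fwdSearch-first : ∀ {occ t} f s → (∀ t' → s ≤ t' → t' < t → isFree n occ t' ≡ false) →
                    isFree n occ t ≡ true → s ≤ t → t < s + f → fwdSearch n occ f s ≡ just t
  fwdSearch-first {t = t} zero s _ _ s≤t t<s+0 = contradiction (subst (t <_) (+-identityʳ s) t<s+0) (≤⇒≯ s≤t)
  fwdSearch-first {occ} {t} (suc f) s taken free s≤t t<s+1+f with m≤n⇒m<n∨m≡n s≤t
  ... | inj₂ refl rewrite free = refl
  ... | inj₁ s<t rewrite taken s ≤-refl s<t =
    fwdSearch-first f (suc s) (λ t' s<t' → taken t' (<⇒≤ s<t')) free s<t (subst (t <_) (+-suc s f) t<s+1+f)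

module Naples (k n : ℕ) where
  open Lot n

  data SpotChoice (occ : List ℕ) (a : ℕ) : Maybe ℕ → Set where
    preferred : isFree n occ a ≡ true → SpotChoice occ a (just a)
    behind    : ∀ {t} → isFree n occ a ≡ false → backSearch n occ a k ≡ just t → SpotChoice occ a (just t)
    ahead     : isFree n occ a ≡ false → backSearch n occ a k ≡ nothing →
                SpotChoice occ a (fwdSearch n occ n (suc a))

  spotChoice : ∀ occ a → SpotChoice occ a (naplesSpot k n occ a)
  spotChoice occ a with isFree n occ a in free
  ... | true  = preferred free
  ... | false with backSearch n occ a k in back
  ...   | just _  = behind free back
  ...   | nothing = ahead free back

  naplesSpot-free : ∀ {occ a t} → naplesSpot k n occ a ≡ just t → isFree n occ t ≡ true × a ≤ t + k
  naplesSpot-free {occ} {a} e with naplesSpot k n occ a | spotChoice occ a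
  naplesSpot-free refl | _ | preferred free = free , m≤m+n _ k
  naplesSpot-free refl | _ | behind _ back  = let _ , _ , a≤t+k , free = backSearch-just k back in free , a≤t+k
  naplesSpot-free e    | _ | ahead _ _      = let a<t , free = fwdSearch-just n _ e in
                                              free , ≤-trans (<⇒≤ a<t) (m≤m+n _ k)

  naplesSpot-behind : ∀ {occ a t} → naplesSpot k n occ a ≡ just t → t < a →
                      isFree n occ a ≡ false × (∀ t' → t < t' → t' < a → isFree n occ t' ≡ false)
  naplesSpot-behind {occ} {a} e t<a with naplesSpot k n occ a | spotChoice occ a
  naplesSpot-behind refl t<a | _ | preferred _      = contradiction t<a (<-irrefl refl)
  naplesSpot-behind refl t<a | _ | behind taken back = taken , backSearch-first k back
  naplesSpot-behind e    t<a | _ | ahead _ _        =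
    contradiction (<-trans t<a (proj₁ (fwdSearch-just n _ e))) (<-irrefl refl)

  naplesSpot-count : ∀ {occ a t} → naplesSpot k n occ a ≡ just t →
                     occupiedCount (t ∷ occ) ≡ suc (occupiedCount occ)
  naplesSpot-count {occ} {a} {t} e = occupiedCount-∷ occ t (proj₁ (naplesSpot-free {occ} {a} e))

  naplesSpot-fills : ∀ {occ a t} → naplesSpot k n occ a ≡ just t → t < a → a ≤ n →
                     (∀ x → 1 ≤ x → x < t → occupied occ x ≡ true) →
                     ∀ x → 1 ≤ x → x ≤ a → occupied (t ∷ occ) x ≡ true
  naplesSpot-fills {occ} {a} {t} e t<a a≤n below x 1≤x x≤a with naplesSpot-behind {occ} {a} e t<a | <-cmp x t
  ... | _ , _ | tri< x<t _ _ = occupied-there t occ x (below x 1≤x x<t)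
  ... | _ , _ | tri≈ _ refl _ = occupied-here t occ
  ... | taken-a , taken-between | tri> _ _ t<x with m≤n⇒m<n∨m≡n x≤a
  ...   | inj₁ x<a  =
    occupied-there t occ x (taken⇒occupied occ (taken-between x t<x x<a) 1≤x (≤-trans (<⇒≤ x<a) a≤n))
  ...   | inj₂ refl = occupied-there t occ x (taken⇒occupied occ taken-a 1≤x a≤n)

  record Filled (occ : List ℕ) (u d : ℕ) : Set where
    constructor filled
    field
      count   : occupiedCount occ ≡ u
      prefix  : ∀ t → 1 ≤ t → t ≤ u → occupied occ t ≡ true
      bounded : ∀ t → occupied occ t ≡ true → t ≤ u
      above   : d ≤ u

  record Excursion (occ : List ℕ) (s u d : ℕ) : Set where
    constructor excursion
    field
      count   : occupiedCount occ ≡ u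
      below   : ∀ t → 1 ≤ t → t < s → occupied occ t ≡ true
      bounded : ∀ t → occupied occ t ≡ true → t ≤ suc d
      under   : u ≤ d

  record Stranded (occ : List ℕ) (s u d : ℕ) : Set where
    constructor stranded
    field
      count    : occupiedCount occ ≡ u
      below    : ∀ t → 1 ≤ t → t < s → occupied occ t ≡ true
      vacant   : occupied occ s ≡ false
      positive : 1 ≤ s
      passed   : s ≤ d
      unreached : s + k ≤ d ⊎ (u ≤ d × d < s + k)

  filled-[] : Filled [] 0 0
  filled-[] =
    filled (countTo-beyond _ n (λ _ ()) z≤n) (λ _ 1≤t t≤0 → contradiction (≤-trans 1≤t t≤0) λ ()) (λ _ ()) z≤n

  filled-vacancy : ∀ {occ u d} → Filled occ u d → suc u ≤ n → isFree n occ (suc u) ≡ true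
  filled-vacancy {occ} (filled _ _ bounded _) 1+u≤n =
    isFree⇐ occ (s≤s z≤n) 1+u≤n (unoccupied-beyond occ bounded ≤-refl)

  filled-spot : ∀ {occ u d} → Filled occ u d → suc u ≤ n → naplesSpot k n occ (suc d) ≡ just (suc u)
  filled-spot {occ} {u} {d} F@(filled _ prefix _ d≤u) 1+u≤n
    with naplesSpot k n occ (suc d) | spotChoice occ (suc d)
  ... | _ | preferred free =
    cong (just ∘ suc) (≤-antisym d≤u (≮⇒≥ λ d<u → free⇒unoccupied occ _ free (prefix (suc d) (s≤s z≤n) d<u)))
  ... | _ | behind _ back =
    let 1≤t , t<1+d , _ , free = backSearch-just k back in
    ⊥-elim (free⇒unoccupied occ _ free (prefix _ 1≤t (≤-trans (m<1+n⇒m≤n t<1+d) d≤u)))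
  ... | _ | ahead taken _ =
    fwdSearch-first n (suc (suc d))
      (λ t 2+d≤t t<1+u → occupied⇒taken occ t (prefix t (≤-trans (s≤s z≤n) 2+d≤t) (m<1+n⇒m≤n t<1+u)))
      (filled-vacancy F 1+u≤n) (s≤s d<u) (s≤s (≤-trans 1+u≤n (m≤n+m n (suc d))))
    where
    d<u : d < u
    d<u = ≤∧≢⇒< d≤u λ { refl → contradiction (trans (sym taken) (filled-vacancy F 1+u≤n)) λ () }

  filled-D : ∀ {occ u d} → Filled occ u d → u ≢ d → Filled occ u (suc d)
  filled-D (filled count prefix bounded d≤u) u≢d = filled count prefix bounded (≤∧≢⇒< d≤u (u≢d ∘ sym))

  filled-∷ : ∀ {occ u d} → Filled occ u d → suc u ≤ n → Filled (suc u ∷ occ) (suc u) d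
  filled-∷ {occ} {u} F@(filled count prefix bounded d≤u) 1+u≤n =
    filled (trans (occupiedCount-∷ occ (suc u) (filled-vacancy F 1+u≤n)) (cong suc count)) prefix′
           (bounded-∷ occ ≤-refl λ x o → m≤n⇒m≤1+n (bounded x o)) (m≤n⇒m≤1+n d≤u)
    where
    prefix′ : ∀ t → 1 ≤ t → t ≤ suc u → occupied (suc u ∷ occ) t ≡ true
    prefix′ t 1≤t t≤1+u with m≤n⇒m<n∨m≡n t≤1+u
    ... | inj₁ t≤u  = occupied-there (suc u) occ t (prefix t 1≤t (m<1+n⇒m≤n t≤u))
    ... | inj₂ refl = occupied-here (suc u) occ

  excursion-spot : ∀ {occ s u d} → Excursion occ s u d → suc d ≤ s + k → suc d ≤ n →
                   Σ ℕ λ t → naplesSpot k n occ (suc d) ≡ just t × t ≤ suc d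
  excursion-spot {occ} {s} {u} {d} (excursion count below _ u≤d) 1+d≤s+k 1+d≤n
    with naplesSpot k n occ (suc d) | spotChoice occ (suc d)
  ... | _ | preferred _   = suc d , refl , ≤-refl
  ... | _ | behind _ back = _ , refl , <⇒≤ (proj₁ (proj₂ (backSearch-just k back)))
  ... | _ | ahead taken back =
    contradiction (≤-trans (subst (suc d ≤_) count (crowded occ all-taken 1+d≤n)) u≤d) 1+n≰n
    where
    all-taken : ∀ t → 1 ≤ t → t ≤ suc d → occupied occ t ≡ true
    all-taken t 1≤t t≤1+d with m≤n⇒m<n∨m≡n t≤1+d | t <? s
    ... | inj₂ refl  | _       = taken⇒occupied occ taken 1≤t 1+d≤n
    ... | inj₁ _     | yes t<s = below t 1≤t t<s
    ... | inj₁ t<1+d | no  t≮s =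
      taken⇒occupied occ (backSearch-nothing k back 1≤t t<1+d (≤-trans 1+d≤s+k (+-monoˡ-≤ k (≮⇒≥ t≮s))))
        1≤t (≤-trans (<⇒≤ t<1+d) 1+d≤n)

  excursion-∷ : ∀ {occ s u d t} → Excursion occ s u d → naplesSpot k n occ (suc d) ≡ just t → t ≤ suc d →
                suc u ≤ d → Excursion (t ∷ occ) s (suc u) d
  excursion-∷ {occ} {t = t} (excursion count below bounded _) e t≤1+d 1+u≤d =
    excursion (trans (naplesSpot-count {occ} e) (cong suc count))
              (λ x 1≤x x<s → occupied-there t occ x (below x 1≤x x<s)) (bounded-∷ occ t≤1+d bounded) 1+u≤d

  excursion-D : ∀ {occ s u d} → Excursion occ s u d → Excursion occ s u (suc d)
  excursion-D (excursion count below bounded u≤d) =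
    excursion count below (λ t o → m≤n⇒m≤1+n (bounded t o)) (m≤n⇒m≤1+n u≤d)

  excursion-return : ∀ {occ s u d t} → Excursion occ s u d → naplesSpot k n occ (suc d) ≡ just t → t ≤ suc d →
                     u ≡ d → suc u ≤ n → Filled (t ∷ occ) (suc u) d
  excursion-return {occ} {d = d} {t} (excursion count _ bounded _) e t≤1+d refl 1+u≤n =
    filled count′ (packed (t ∷ occ) bounded′ count′ 1+u≤n) bounded′ (n≤1+n _)
    where
    bounded′ : ∀ x → occupied (t ∷ occ) x ≡ true → x ≤ suc d
    bounded′ = bounded-∷ occ t≤1+d bounded
    count′ : occupiedCount (t ∷ occ) ≡ suc d
    count′ = trans (naplesSpot-count {occ} e) (cong suc count)

  filled⇒excursion : ∀ {occ u} → Filled occ u u → Excursion occ (suc u) u (suc u)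
  filled⇒excursion (filled count prefix bounded _) =
    excursion count (λ t 1≤t t<1+u → prefix t 1≤t (m<1+n⇒m≤n t<1+u))
                    (λ t o → m≤n⇒m≤1+n (m≤n⇒m≤1+n (bounded t o))) (n≤1+n _)

  filled⇒stranded : ∀ {occ u} → 1 ≤ k → Filled occ u u → Stranded occ (suc u) u (suc u)
  filled⇒stranded {occ} {u} 1≤k (filled count prefix bounded _) =
    stranded count (λ t 1≤t t<1+u → prefix t 1≤t (m<1+n⇒m≤n t<1+u)) (unoccupied-beyond occ bounded ≤-refl)
             (s≤s z≤n) ≤-refl (inj₂ (n≤1+n u , m<m+n (suc u) 1≤k))

  stranded-D : ∀ {occ s u d} → Stranded occ s u d → Stranded occ s u (suc d)
  stranded-D {s = s} {u} {d} (stranded count below vacant 1≤s s≤d unreached) =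
    stranded count below vacant 1≤s (m≤n⇒m≤1+n s≤d) (step unreached)
    where
    step : s + k ≤ d ⊎ (u ≤ d × d < s + k) → s + k ≤ suc d ⊎ (u ≤ suc d × suc d < s + k)
    step (inj₁ far) = inj₁ (m≤n⇒m≤1+n far)
    step (inj₂ (u≤d , d<s+k)) with m≤n⇒m<n∨m≡n d<s+k
    ... | inj₁ 1+d<s+k = inj₂ (m≤n⇒m≤1+n u≤d , 1+d<s+k)
    ... | inj₂ 1+d≡s+k = inj₁ (≤-reflexive (sym 1+d≡s+k))

  stranded-U : ∀ {occ s u d t} → Stranded occ s u d → naplesSpot k n occ (suc d) ≡ just t → suc d ≤ n →
               (u ≤ d → d < s + k → u < d) → Stranded (t ∷ occ) s (suc u) d
  stranded-U {occ} {s} {u} {d} {t} (stranded count below vacant 1≤s s≤d unreached) e 1+d≤n no-return =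
    stranded count′ (λ x 1≤x x<s → occupied-there t occ x (below x 1≤x x<s))
             (unoccupied-∷ occ (t≢s unreached) vacant) 1≤s s≤d
             (map₂ (λ (u≤d , d<s+k) → no-return u≤d d<s+k , d<s+k) unreached)
    where
    count′ : occupiedCount (t ∷ occ) ≡ suc u
    count′ = trans (naplesSpot-count {occ} e) (cong suc count)
    t≢s : s + k ≤ d ⊎ (u ≤ d × d < s + k) → t ≢ s
    t≢s (inj₁ s+k≤d) refl = contradiction (≤-trans (proj₂ (naplesSpot-free {occ} e)) s+k≤d) 1+n≰n
    t≢s (inj₂ (u≤d , d<s+k)) refl =
      let filled-to-1+d = naplesSpot-fills {occ} e (s≤s s≤d) 1+d≤n below in
      contradiction (≤-trans (subst (suc d ≤_) count′ (crowded (s ∷ occ) filled-to-1+d 1+d≤n)) (no-return u≤d d<s+k))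
                    1+n≰n

  stranded-end : ∀ {occ s d} → Stranded occ s n d → s ≤ n → ⊥
  stranded-end {occ} (stranded count _ vacant 1≤s _ _) s≤n =
    contradiction (subst (_< n) count (countTo-missing (occupied occ) n vacant 1≤s s≤n)) (<-irrefl refl)

module Walk (k n : ℕ) (P : Path) (#U≡n : #U P ≡ n) (#D≡n : #D P ≡ n) (last≡D : last P ≡ just D) (1≤k : 1 ≤ k)
  where
  open Lot n
  open Naples k n

  record At (m : ℕ) (q : Path) (u d : ℕ) : Set where
    constructor at
    field
      rest  : drop m P ≡ q
      ups   : #U (take m P) ≡ u
      downs : #D (take m P) ≡ d

  at-U : ∀ {m q u d} → At m (U ∷ q) u d → At (suc m) q (suc u) d
  at-U {m} (at rest ups downs) =
    at (drop-suc-∷ m P rest) (trans (#U-take-suc m P rest) (trans (+-comm _ 1) (cong suc ups)))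
                             (trans (#D-take-suc m P rest) (trans (+-identityʳ _) downs))

  at-D : ∀ {m q u d} → At m (D ∷ q) u d → At (suc m) q u (suc d)
  at-D {m} (at rest ups downs) =
    at (drop-suc-∷ m P rest) (trans (#U-take-suc m P rest) (trans (+-identityʳ _) ups))
                             (trans (#D-take-suc m P rest) (trans (+-comm _ 1) (cong suc downs)))

  at-height : ∀ {m q u d} → At m q u d → height (take m P) ≡ + u ℤ.- + d
  at-height (at _ ups downs) = cong₂ (λ a b → + a ℤ.- + b) ups downs

  at-< : ∀ {m x q u d} → At m (x ∷ q) u d → m < length P
  at-< {m} (at rest _ _) = drop-∷⇒< m P rest

  at-position : ∀ {m x q u d} → At m (x ∷ q) u d → u + d ≡ m
  at-position {m} A@(at _ ups downs) = trans (cong₂ _+_ (sym ups) (sym downs)) (#U+#D-take m P (<⇒≤ (at-< A)))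

  at-end : ∀ {m u d} → At m [] u d → length P ≤ m
  at-end {m} (at rest _ _) = drop-[]⇒≤ m P rest

  at-end-ups : ∀ {m u d} → At m [] u d → u ≡ n
  at-end-ups {m} A@(at _ ups _) = trans (sym ups) (trans (cong #U (take-all m P (at-end A))) #U≡n)

  at-downs-≤ : ∀ {m q u d} → At m q u d → d ≤ n
  at-downs-≤ {m} (at _ _ downs) = subst₂ _≤_ downs #D≡n (#D-take-≤ m P)

  -- Preferences never exceed n because P ends with a Down step.
  at-U-bounds : ∀ {m q u d} → At m (U ∷ q) u d → suc u ≤ n × suc d ≤ n
  at-U-bounds {m} A@(at rest _ downs) =
    subst₂ _≤_ (At.ups (at-U A)) #U≡n (#U-take-≤ (suc m) P) ,
    subst₂ _≤_ (cong suc downs) #D≡n (#D-take-< m P last≡D rest)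

  Dip : ℕ → Set
  Dip j = ∃ λ q → drop j P ≡ D ∷ q × height (take j P) ≡ + 0

  Returns : ℕ → Set
  Returns j = ∃ λ r → suc j < r × r ≤ suc j + 2 * k × r ≤ length P × height (take r P) ≡ + 1

  ReturnsFrom : ℕ → Set
  ReturnsFrom m = ∀ j → m ≤ j → Dip j → Returns j

  returns? : ∀ j → Dec (Returns j)
  returns? j =
    map′ (λ (r , r<2+j+2k , j<r , r≤len , h) → r , j<r , m<1+n⇒m≤n r<2+j+2k , r≤len , h)
         (λ (r , j<r , r≤1+j+2k , r≤len , h) → r , s≤s r≤1+j+2k , j<r , r≤len , h)
         (anyUpTo? (λ r → suc j <? r ×-dec r ≤? length P ×-dec height (take r P) ℤ.≟ + 1)
                   (suc (suc j + 2 * k)))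

  returnsFrom-step : ∀ {m} → (Dip m → Returns m) → ReturnsFrom m ⇔ ReturnsFrom (suc m)
  returnsFrom-step {m} here = mk⇔ (λ rf j m<j → rf j (<⇒≤ m<j)) from
    where
    from : ReturnsFrom (suc m) → ReturnsFrom m
    from rf j m≤j dip with m≤n⇒m<n∨m≡n m≤j
    ... | inj₁ m<j  = rf j m<j dip
    ... | inj₂ refl = here dip

  returnsFrom-end : ∀ {m u d} → At m [] u d → ReturnsFrom m
  returnsFrom-end A j m≤j (_ , rest , _) =
    contradiction (drop-∷⇒< j P rest) (≤⇒≯ (≤-trans (at-end A) m≤j))

  not-dip-U : ∀ {m q u d} → At m (U ∷ q) u d → ¬ Dip m
  not-dip-U (at rest _ _) (_ , rest′ , _) with trans (sym rest) rest′
  ... | ()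

  dip-balanced : ∀ {m q u d} → At m q u d → Dip m → u ≡ d
  dip-balanced A (_ , _ , h) = height≡0⇒ _ _ (trans (sym (at-height A)) h)

  dip : ∀ {m q u} → At m (D ∷ q) u u → Dip m
  dip {u = u} A = _ , At.rest A , trans (at-height A) (height≡0⇐ u)

  Parks : List ℕ → ℕ → Path → Set
  Parks occ d q = ∃ λ F → naplesPark k n occ (prefFrom d q) ≡ just F

  parks-U : ∀ {occ d t} q → naplesSpot k n occ (suc d) ≡ just t →
            Parks occ d (U ∷ q) ⇔ Parks (t ∷ occ) d q
  parks-U {occ} {d} q spot rewrite spot = ⇔.refl

  -- The excursion after the dip at position e + e, which left spot suc e empty; it reaches
  -- height 1 at position r.
  record Window (m e : ℕ) : Set where
    constructor window
    field
      r        : ℕ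
      started  : e + e < m
      pending  : m < r
      deadline : r ≤ suc (e + e) + 2 * k
      inside   : r ≤ length P
      returned : height (take r P) ≡ + 1

  window-reach : ∀ {m e x q u d} → Window m e → At m (x ∷ q) u d → suc d ≤ suc e + k
  window-reach {m} {e} (window r _ pending deadline inside returned) (at _ _ downs) =
    s≤s (≤-trans (subst (_≤ #D (take r P)) downs (#D-take-mono P (<⇒≤ pending))) (halve-≤ e k dr+dr≤))
    where
    dr+dr≤ : #D (take r P) + #D (take r P) ≤ (e + e) + 2 * k
    dr+dr≤ = s≤s⁻¹ (subst (_≤ suc (e + e) + 2 * k) (raised-position r P inside returned) deadline)

  window-step : ∀ {m e q u d} → Window m e → At (suc m) q u d → u ≤ d → Window (suc m) e
  window-step (window r started pending deadline inside returned) A u≤d =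
    window r (m<n⇒m<1+n started) (≤∧≢⇒< pending 1+m≢r) deadline inside returned
    where
    1+m≢r : _ ≢ r
    1+m≢r refl =
      contradiction (≤-trans (≤-reflexive (sym (height≡1⇒ _ _ (trans (sym (at-height A)) returned)))) u≤d) 1+n≰n

  dip-window : ∀ {m q u} → At m (D ∷ q) u u → Returns m → Window (suc m) u
  dip-window A (r , 1+m<r , r≤1+m+2k , inside , returned) =
    window r (s≤s (≤-reflexive (at-position A))) 1+m<r
           (subst (λ i → r ≤ suc i + 2 * k) (sym (at-position A)) r≤1+m+2k) inside returned

  window-returns : ∀ {m e} → (W : Window m e) → suc m < Window.r W → Returns m
  window-returns (window r started _ deadline inside returned) 1+m<r =
    r , 1+m<r , ≤-trans deadline (+-monoˡ-≤ (2 * k) (s≤s (<⇒≤ started))) , inside , returned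

  lost-walk : ∀ {m occ e u d i} q → At m q u d → Stranded occ (suc e) u d → e + e ≡ i → i < m → ¬ Returns i →
              ¬ Parks occ d q
  lost-walk {occ = occ} {e} {d = d} [] A S _ _ _ _ =
    stranded-end (subst (λ u → Stranded occ (suc e) u d) (at-end-ups A) S)
                 (≤-trans (Stranded.passed S) (at-downs-≤ A))
  lost-walk {m} {occ} {e} {u} {d} {i} (U ∷ q) A S e+e≡i i<m ¬ret with naplesSpot k n occ (suc d) in spot
  ... | nothing = λ ()
  ... | just t  =
    lost-walk q (at-U A) (stranded-U S spot (proj₂ (at-U-bounds A)) no-return) e+e≡i (m<n⇒m<1+n i<m) ¬ret
    where
    returned : u ≡ d → d < suc e + k → Returns i
    returned refl d<1+e+k =
      suc m , s≤s i<m ,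
      s≤s (subst₂ _≤_ (at-position A) (cong (_+ 2 * k) e+e≡i) (double-≤ e k (s≤s⁻¹ d<1+e+k))) ,
      at-< A , trans (at-height (at-U A)) (height≡1⇐ u)
    no-return : u ≤ d → d < suc e + k → u < d
    no-return u≤d d<1+e+k = ≤∧≢⇒< u≤d λ u≡d → ¬ret (returned u≡d d<1+e+k)
  lost-walk (D ∷ q) A S e+e≡i i<m ¬ret = lost-walk q (at-D A) (stranded-D S) e+e≡i (m<n⇒m<1+n i<m) ¬ret

  step-U : ∀ {m occ q u d t} → At m (U ∷ q) u d → naplesSpot k n occ (suc d) ≡ just t →
           ReturnsFrom (suc m) ⇔ Parks (t ∷ occ) d q → ReturnsFrom m ⇔ Parks occ d (U ∷ q)
  step-U {q = q} A spot rest =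
    ⇔.trans (returnsFrom-step (⊥-elim ∘ not-dip-U A)) (⇔.trans rest (⇔.sym (parks-U q spot)))

  mutual
    filled-walk : ∀ {m occ u d} q → At m q u d → Filled occ u d → ReturnsFrom m ⇔ Parks occ d q
    filled-walk []      A _ = mk⇔ (λ _ → _ , refl) (λ _ → returnsFrom-end A)
    filled-walk (U ∷ q) A F = let 1+u≤n = proj₁ (at-U-bounds A) in
      step-U A (filled-spot F 1+u≤n) (filled-walk q (at-U A) (filled-∷ F 1+u≤n))
    filled-walk {m} {u = u} {d} (D ∷ q) A F with u ≟ d
    ... | no u≢d =
      ⇔.trans (returnsFrom-step (⊥-elim ∘ u≢d ∘ dip-balanced A)) (filled-walk q (at-D A) (filled-D F u≢d))
    ... | yes refl with returns? m
    ...   | yes ret = ⇔.trans (returnsFrom-step (λ _ → ret))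
                              (excursion-walk q (at-D A) (filled⇒excursion F) (dip-window A ret))
    ...   | no ¬ret = mk⇔ (λ rf → ⊥-elim (¬ret (rf m ≤-refl (dip A))))
                          (⊥-elim ∘ lost-walk q (at-D A) (filled⇒stranded 1≤k F) (at-position A) ≤-refl ¬ret)

    excursion-walk : ∀ {m occ e u d} q → At m q u d → Excursion occ (suc e) u d → Window m e →
                     ReturnsFrom m ⇔ Parks occ d q
    excursion-walk [] A _ W = contradiction (≤-trans (Window.pending W) (Window.inside W)) (≤⇒≯ (at-end A))
    excursion-walk {u = u} {d} (U ∷ q) A X W
      with excursion-spot X (window-reach W A) (proj₂ (at-U-bounds A)) | u ≟ d
    ... | t , spot , t≤1+d | yes refl =
      step-U A spot (filled-walk q (at-U A) (excursion-return X spot t≤1+d refl (proj₁ (at-U-bounds A))))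
    ... | t , spot , t≤1+d | no u≢d = let u<d = ≤∧≢⇒< (Excursion.under X) u≢d in
      step-U A spot (excursion-walk q (at-U A) (excursion-∷ X spot t≤1+d u<d) (window-step W (at-U A) u<d))
    excursion-walk (D ∷ q) A X W =
      ⇔.trans (returnsFrom-step (λ _ → window-returns W (Window.pending W′)))
              (excursion-walk q (at-D A) (excursion-D X) W′)
      where
      W′ = window-step W (at-D A) (m≤n⇒m≤1+n (Excursion.under X))

  returnsAbove⇔returnsFrom0 : ReturnsAboveWithin2k k P ⇔ ReturnsFrom 0
  returnsAbove⇔returnsFrom0 = mk⇔ to from
    where
    to : ReturnsAboveWithin2k k P → ReturnsFrom 0
    to above j _ (q , rest , h) with fromℕ< (drop-∷⇒< j P rest) | toℕ-fromℕ< (drop-∷⇒< j P rest)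
    ... | i | refl = above i (∷-injectiveˡ (trans (sym (drop-toℕ P i)) rest)) h
    from : ReturnsFrom 0 → ReturnsAboveWithin2k k P
    from rf i lookup≡D h =
      rf (toℕ i) z≤n (_ , trans (drop-toℕ P i) (cong (_∷ drop (suc (toℕ i)) P) lookup≡D) , h)

  at-start : At 0 P 0 0
  at-start = at refl refl refl

theorem3p5 : (k n : ℕ) → 1 ≤ k → 1 ≤ n → (P : Path) → IsKDyck k n P →
    (IsKNaplesPF k n (parkingPreference P) → ReturnsAboveWithin2k k P)
    × (ReturnsAboveWithin2k k P → IsKNaplesPF k n (parkingPreference P))
theorem3p5 k n 1≤k _ P (#U≡n , #D≡n , _ , last≡D) = Equivalence.from equivalence , Equivalence.to equivalence
  where
  open Walk k n P #U≡n #D≡n last≡D 1≤k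
  open Naples k n using (filled-[])
  equivalence : ReturnsAboveWithin2k k P ⇔ IsKNaplesPF k n (parkingPreference P)
  equivalence = ⇔.trans returnsAbove⇔returnsFrom0 (filled-walk P at-start filled-[])
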